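{- For all $N,M\in\mathbb{Z}_{\ge0}$, $$\begin{bmatrix}2N+2M\\ 2N\end{bmatrix}_{\sqrt q}=\sum_{j=-M}^{M}q^{j^2+\frac{j}{2}}\,Q(N,M,j,j,q),$$ where $Q(N,M,j,j,q)=\begin{bmatrix}N+M\\ N+j\end{bmatrix}_q\begin{bmatrix}N+M\\ N-j\end{bmatrix}_q$.
   Context: $(x;p)_j=\prod_{i=0}^{j-1}(1-xp^i)$. For a base $p$ and integers $N,j$: $\begin{bmatrix}N\\ j\end{bmatrix}_p=\frac{(p^{N-j+1};p)_j}{(p;p)_j}$ if $j\ge0$ and $0$ otherwise; the base $\sqrt q$ means $p=q^{1/2}$. In general $Q(N,M,c,d,q)=\begin{bmatrix}N+M+c-d\\ N+c\end{bmatrix}_q\begin{bmatrix}N+M-c+d\\ N-c\end{bmatrix}_q$. -}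

module Defs where

open import Data.Nat as ℕ using (ℕ; zero; suc)
open import Data.Integer as ℤ using (ℤ; +_; -[1+_])
open import Data.Rational using (ℚ; 0ℚ; 1ℚ; _+_; _*_; _-_; _÷_; ≢-nonZero)
open import Data.Rational.Properties using (_≟_)
open import Data.List using (List; map; upTo; foldr)
open import Relation.Nullary using (yes; no)

_^_ : ℚ → ℕ → ℚ
x ^ zero = 1ℚ
x ^ suc n = x * (x ^ n)

-- division; the value at a zero denominator is a junk value (0) and is never
-- used under the hypotheses of the theorem
_⊘_ : ℚ → ℚ → ℚ
x ⊘ y with y ≟ 0ℚ
... | yes _ = 0ℚ
... | no y≢0 = _÷_ x y {{≢-nonZero y≢0}}

_^ᶻ_ : ℚ → ℤ → ℚ
x ^ᶻ (+ n) = x ^ n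
x ^ᶻ -[1+ n ] = 1ℚ ⊘ (x ^ suc n)

poch : ℚ → ℚ → ℕ → ℚ
poch x p zero = 1ℚ
poch x p (suc j) = poch x p j * (1ℚ - x * (p ^ j))

-- Gaussian binomial [N; j]_p = (p^{N-j+1};p)_j / (p;p)_j for j ≥ 0, 0 otherwise
gauss : ℚ → ℤ → ℤ → ℚ
gauss p N (+ j) = poch (p ^ᶻ (N ℤ.- + j ℤ.+ + 1)) p j ⊘ poch p p j
gauss p N -[1+ j ] = 0ℚ

Q : ℤ → ℤ → ℤ → ℤ → ℚ → ℚ
Q N M c d q = gauss q (N ℤ.+ M ℤ.+ c ℤ.- d) (N ℤ.+ c)
            * gauss q (N ℤ.+ M ℤ.- c ℤ.+ d) (N ℤ.- c)

sumSym : ℕ → (ℤ → ℚ) → ℚ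
sumSym M f = foldr (λ i acc → f (+ i ℤ.- + M) + acc) 0ℚ (upTo (suc (2 ℕ.* M)))

module Submission where

-- Expand ∏_{i<2L} (1 + p^i x), L = N + M, by the q-binomial theorem in two
-- ways: directly, and as the product of its even factors ∏_{i<L} (1 + q^i x)
-- and its odd factors ∏_{i<L} (1 + p q^i x), where q = p².  The coefficient of
-- x^(2N) is p^(2N choose 2) [2L; 2N]_p on the one side and a convolution of two
-- q-binomial expansions on the other; indexing the convolution by b = N + j
-- turns it into p^(2N choose 2) Σ_{|j| ≤ N} q^(j² + j/2) Q(N,M,j,j,q).
-- Cancelling p^(2N choose 2) needs p ≠ 0 (p = 0 is checked directly), and since
-- Q(N,M,j,j,q) = 0 for |j| > min(N, M) the sum over |j| ≤ N equals the one
-- over |j| ≤ M.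

open import Data.Empty using (⊥-elim)
open import Data.List using ([]; _∷_; foldr; applyUpTo)
open import Data.Nat using (ℕ; zero; suc; _≤_; _<_; _∸_; z≤n; s≤s; _≤?_)
import Data.Nat as ℕ
import Data.Nat.Properties as ℕₚ
import Data.Nat.Tactic.RingSolver as ℕ-Ring
open import Data.Integer as ℤ using (ℤ; +_; -[1+_]; ∣_∣)
import Data.Integer.Properties as ℤₚ
import Data.Integer.Tactic.RingSolver as ℤ-Ring
open import Data.Product using (_,_)
open import Data.Rational using (ℚ; 0ℚ; 1ℚ; _+_; _*_; _-_; 1/_; ≢-nonZero)
import Data.Rational.Properties as ℚₚ
open import Data.Rational.Solver using (module +-*-Solver)
open import Data.Sum using (inj₁; inj₂)
open import Function using (_∘_)
open import Relation.Nullary using (yes; no)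
open import Relation.Binary.PropositionalEquality
  using (_≡_; _≢_; _≗_; refl; sym; trans; cong; cong₂; subst; module ≡-Reasoning)

open import Defs

open +-*-Solver
open ≡-Reasoning

-- Triangular numbers and the exponent 2j² + j

tri : ℕ → ℕ
tri zero    = 0
tri (suc k) = k ℕ.+ tri k

tri-+ : ∀ m n → tri (m ℕ.+ n) ≡ tri m ℕ.+ tri n ℕ.+ m ℕ.* n
tri-+ zero    n = sym (ℕₚ.+-identityʳ (tri n))
tri-+ (suc m) n = begin
  m ℕ.+ n ℕ.+ tri (m ℕ.+ n)                  ≡⟨ cong (m ℕ.+ n ℕ.+_) (tri-+ m n) ⟩
  m ℕ.+ n ℕ.+ (tri m ℕ.+ tri n ℕ.+ m ℕ.* n)  ≡⟨ rearrange m n (tri m) (tri n) ⟩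
  m ℕ.+ tri m ℕ.+ tri n ℕ.+ (n ℕ.+ m ℕ.* n)  ∎
  where
  rearrange : ∀ m n s t → m ℕ.+ n ℕ.+ (s ℕ.+ t ℕ.+ m ℕ.* n)
                        ≡ m ℕ.+ s ℕ.+ t ℕ.+ (n ℕ.+ m ℕ.* n)
  rearrange = ℕ-Ring.solve-∀

tri-double : ∀ k → tri k ℕ.+ tri k ℕ.+ k ≡ k ℕ.* k
tri-double zero    = refl
tri-double (suc k) = begin
  k ℕ.+ tri k ℕ.+ (k ℕ.+ tri k) ℕ.+ suc k    ≡⟨ rearrange k (tri k) ⟩
  suc (k ℕ.+ k) ℕ.+ (tri k ℕ.+ tri k ℕ.+ k)  ≡⟨ cong (suc (k ℕ.+ k) ℕ.+_) (tri-double k) ⟩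
  suc (k ℕ.+ k) ℕ.+ k ℕ.* k                  ≡⟨ ℕ-Ring.solve (k ∷ []) ⟩
  suc k ℕ.* suc k                            ∎
  where
  rearrange : ∀ k t → k ℕ.+ t ℕ.+ (k ℕ.+ t) ℕ.+ suc k ≡ suc (k ℕ.+ k) ℕ.+ (t ℕ.+ t ℕ.+ k)
  rearrange = ℕ-Ring.solve-∀

+tri-double : ∀ k → + (tri k ℕ.+ tri k) ≡ + k ℤ.* + k ℤ.- + k
+tri-double k = begin
  + t                    ≡⟨ cancel (+ t) (+ k) ⟩
  + t ℤ.+ + k ℤ.- + k    ≡⟨ cong (λ n → + n ℤ.- + k) (tri-double k) ⟩
  + (k ℕ.* k) ℤ.- + k    ≡⟨ cong (ℤ._- + k) (ℤₚ.pos-* k k) ⟩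
  + k ℤ.* + k ℤ.- + k    ∎
  where
  t = tri k ℕ.+ tri k
  cancel : ∀ x y → x ≡ x ℤ.+ y ℤ.- y
  cancel = ℤ-Ring.solve-∀

2*n≡n+n : ∀ n → 2 ℕ.* n ≡ n ℕ.+ n
2*n≡n+n = ℕ-Ring.solve-∀

-- p ^ ∣ expo j ∣ is the power q^(j² + j/2) of the theorem, with q = p²
expo : ℤ → ℤ
expo j = + 2 ℤ.* j ℤ.* j ℤ.+ j

pos-2*n*n : ∀ n → + (2 ℕ.* n ℕ.* n) ≡ + 2 ℤ.* + n ℤ.* + n
pos-2*n*n n = trans (ℤₚ.pos-* (2 ℕ.* n) n) (cong (ℤ._* + n) (ℤₚ.pos-* 2 n))

expo-+ : ∀ n → expo (+ n) ≡ + (2 ℕ.* n ℕ.* n ℕ.+ n)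
expo-+ n = cong (ℤ._+ + n) (sym (pos-2*n*n n))

expo-[1+] : ∀ n → expo -[1+ n ] ≡ + suc (2 ℕ.* n ℕ.* n ℕ.+ 3 ℕ.* n)
expo-[1+] n = begin
  expo (ℤ.- (+ 1 ℤ.+ + n))                        ≡⟨ expand (+ n) ⟩
  + 1 ℤ.+ (+ 2 ℤ.* + n ℤ.* + n ℤ.+ + 3 ℤ.* + n)  ≡⟨ cong₂ (λ x y → + 1 ℤ.+ (x ℤ.+ y))
                                                         (sym (pos-2*n*n n)) (sym (ℤₚ.pos-* 3 n)) ⟩
  + suc (2 ℕ.* n ℕ.* n ℕ.+ 3 ℕ.* n)              ∎
  where
  expand : ∀ i → let m = ℤ.- (+ 1 ℤ.+ i) in
           + 2 ℤ.* m ℤ.* m ℤ.+ m ≡ + 1 ℤ.+ (+ 2 ℤ.* i ℤ.* i ℤ.+ + 3 ℤ.* i)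
  expand = ℤ-Ring.solve-∀

expo-nonneg : ∀ j → ℤ.0ℤ ℤ.≤ expo j
expo-nonneg (+ n)    = subst (ℤ.0ℤ ℤ.≤_) (sym (expo-+ n)) (ℤ.+≤+ z≤n)
expo-nonneg -[1+ n ] = subst (ℤ.0ℤ ℤ.≤_) (sym (expo-[1+] n)) (ℤ.+≤+ z≤n)

tri-exponent : ∀ N a b j → + N ℤ.- j ≡ + a → + N ℤ.+ j ≡ + b →
               tri (N ℕ.+ N) ℕ.+ ∣ expo j ∣ ≡ (tri a ℕ.+ tri a) ℕ.+ (b ℕ.+ (tri b ℕ.+ tri b))
tri-exponent N a b j N-j≡a N+j≡b = ℤₚ.+-injective (begin
  + tri (N ℕ.+ N) ℤ.+ + ∣ expo j ∣
    ≡⟨ cong₂ ℤ._+_ (cong +_ (tri-+ N N)) (ℤₚ.0≤i⇒+∣i∣≡i (expo-nonneg j)) ⟩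
  + (tri N ℕ.+ tri N) ℤ.+ + (N ℕ.* N) ℤ.+ expo j
    ≡⟨ cong₂ (λ u v → u ℤ.+ v ℤ.+ expo j) (+tri-double N) (ℤₚ.pos-* N N) ⟩
  (+ N ℤ.* + N ℤ.- + N) ℤ.+ + N ℤ.* + N ℤ.+ expo j
    ≡⟨ balance (+ N) j ⟩
  square-minus (+ N ℤ.- j) ℤ.+ (+ N ℤ.+ j ℤ.+ square-minus (+ N ℤ.+ j))
    ≡⟨ cong₂ (λ u v → square-minus u ℤ.+ (v ℤ.+ square-minus v)) N-j≡a N+j≡b ⟩
  square-minus (+ a) ℤ.+ (+ b ℤ.+ square-minus (+ b))
    ≡⟨ sym (cong₂ (λ u v → u ℤ.+ (+ b ℤ.+ v)) (+tri-double a) (+tri-double b)) ⟩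
  + (tri a ℕ.+ tri a) ℤ.+ (+ b ℤ.+ + (tri b ℕ.+ tri b))
    ∎)
  where
  square-minus : ℤ → ℤ
  square-minus x = x ℤ.* x ℤ.- x
  balance : ∀ n j → (n ℤ.* n ℤ.- n) ℤ.+ n ℤ.* n ℤ.+ (+ 2 ℤ.* j ℤ.* j ℤ.+ j)
                  ≡ ((n ℤ.- j) ℤ.* (n ℤ.- j) ℤ.- (n ℤ.- j))
                    ℤ.+ ((n ℤ.+ j) ℤ.+ ((n ℤ.+ j) ℤ.* (n ℤ.+ j) ℤ.- (n ℤ.+ j)))
  balance = ℤ-Ring.solve-∀

^-+ : ∀ x m n → x ^ (m ℕ.+ n) ≡ x ^ m * x ^ n
^-+ x zero    n = sym (ℚₚ.*-identityˡ (x ^ n))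
^-+ x (suc m) n = trans (cong (x *_) (^-+ x m n)) (sym (ℚₚ.*-assoc x (x ^ m) (x ^ n)))

^-square : ∀ x n → (x * x) ^ n ≡ x ^ (n ℕ.+ n)
^-square x zero    = refl
^-square x (suc n) = begin
  (x * x) * (x * x) ^ n    ≡⟨ cong ((x * x) *_) (^-square x n) ⟩
  (x * x) * x ^ (n ℕ.+ n)  ≡⟨ ℚₚ.*-assoc x x _ ⟩
  x * (x * x ^ (n ℕ.+ n))  ≡⟨ cong (λ k → x * x ^ k) (sym (ℕₚ.+-suc n n)) ⟩
  x * x ^ (n ℕ.+ suc n)    ∎

0^-pos : ∀ n → 0 < n → 0ℚ ^ n ≡ 0ℚ
0^-pos (suc n) _ = ℚₚ.*-zeroˡ (0ℚ ^ n)

⊘*-cancel : ∀ x y → y ≢ 0ℚ → (x ⊘ y) * y ≡ x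
⊘*-cancel x y y≢0 with y ℚₚ.≟ 0ℚ
... | yes y≡0 = ⊥-elim (y≢0 y≡0)
... | no y≢0′ = begin
  x * 1/ y * y    ≡⟨ ℚₚ.*-assoc x (1/ y) y ⟩
  x * (1/ y * y)  ≡⟨ cong (x *_) (ℚₚ.*-inverseˡ y) ⟩
  x * 1ℚ          ≡⟨ ℚₚ.*-identityʳ x ⟩
  x               ∎
  where instance _ = ≢-nonZero y≢0′

0⊘ : ∀ y → 0ℚ ⊘ y ≡ 0ℚ
0⊘ y with y ℚₚ.≟ 0ℚ
... | yes _   = refl
... | no y≢0 = ℚₚ.*-zeroˡ (1/_ y {{≢-nonZero y≢0}})

*-cancelʳ-≡ : ∀ a b y → y ≢ 0ℚ → a * y ≡ b * y → a ≡ b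
*-cancelʳ-≡ a b y y≢0 ay≡by = begin
  a              ≡⟨ sym (cancel a) ⟩
  a * y * 1/ y   ≡⟨ cong (_* 1/ y) ay≡by ⟩
  b * y * 1/ y   ≡⟨ cancel b ⟩
  b              ∎
  where
  instance _ = ≢-nonZero y≢0
  cancel : ∀ x → x * y * 1/ y ≡ x
  cancel x = trans (ℚₚ.*-assoc x y (1/ y)) (trans (cong (x *_) (ℚₚ.*-inverseʳ y)) (ℚₚ.*-identityʳ x))

*-cancelˡ-≡ : ∀ y a b → y ≢ 0ℚ → y * a ≡ y * b → a ≡ b
*-cancelˡ-≡ y a b y≢0 ya≡yb =
  *-cancelʳ-≡ a b y y≢0 (trans (ℚₚ.*-comm a y) (trans ya≡yb (ℚₚ.*-comm y b)))

*-≢0 : ∀ {x y} → x ≢ 0ℚ → y ≢ 0ℚ → x * y ≢ 0ℚ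
*-≢0 {x} {y} x≢0 y≢0 xy≡0 = x≢0 (*-cancelʳ-≡ x 0ℚ y y≢0 (trans xy≡0 (sym (ℚₚ.*-zeroˡ y))))

^-≢0 : ∀ {x} n → x ≢ 0ℚ → x ^ n ≢ 0ℚ
^-≢0 zero    x≢0 = ℚₚ.1≢0
^-≢0 (suc n) x≢0 = *-≢0 x≢0 (^-≢0 n x≢0)

1-x≢0 : ∀ {x} → x ≢ 1ℚ → 1ℚ - x ≢ 0ℚ
1-x≢0 {x} x≢1 1-x≡0 = x≢1 (begin
  x              ≡⟨ solve 1 (λ x → x := con 1ℚ :- (con 1ℚ :- x)) refl x ⟩
  1ℚ - (1ℚ - x)  ≡⟨ cong (1ℚ -_) 1-x≡0 ⟩
  1ℚ             ∎)

NotRootOfUnity : ℚ → Set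
NotRootOfUnity r = ∀ (k : ℕ) → 1 ≤ k → r ^ k ≢ 1ℚ

NotRootOfUnity-square : ∀ {r} → NotRootOfUnity r → NotRootOfUnity (r * r)
NotRootOfUnity-square {r} r-nru k 1≤k rrᵏ≡1 =
  r-nru (k ℕ.+ k) (ℕₚ.≤-trans 1≤k (ℕₚ.m≤m+n k k)) (trans (sym (^-square r k)) rrᵏ≡1)

-- Gaussian binomial coefficients

poch-head : ∀ x r k → poch x r (suc k) ≡ (1ℚ - x) * poch (x * r) r k
poch-head x r zero    = solve 1 (λ x → con 1ℚ :* (con 1ℚ :- x :* con 1ℚ) := (con 1ℚ :- x) :* con 1ℚ) refl x
poch-head x r (suc k) = begin
  poch x r (suc k) * (1ℚ - x * (r * R))  ≡⟨ cong (_* (1ℚ - x * (r * R))) (poch-head x r k) ⟩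
  (1ℚ - x) * P * (1ℚ - x * (r * R))
    ≡⟨ solve 4 (λ x r P R → (con 1ℚ :- x) :* P :* (con 1ℚ :- x :* (r :* R))
                          := (con 1ℚ :- x) :* (P :* (con 1ℚ :- x :* r :* R))) refl x r P R ⟩
  (1ℚ - x) * (P * (1ℚ - x * r * R))      ∎
  where
  P = poch (x * r) r k
  R = r ^ k

poch-vanishes : ∀ x r {i} k → x * r ^ i ≡ 1ℚ → i < k → poch x r k ≡ 0ℚ
poch-vanishes x r (suc k) xrⁱ≡1 i<1+k with ℕₚ.m<1+n⇒m<n∨m≡n i<1+k
... | inj₁ i<k  = trans (cong (_* (1ℚ - x * r ^ k)) (poch-vanishes x r k xrⁱ≡1 i<k))
                        (ℚₚ.*-zeroˡ (1ℚ - x * r ^ k))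
... | inj₂ refl = trans (cong (λ y → poch x r k * (1ℚ - y)) xrⁱ≡1) (ℚₚ.*-zeroʳ (poch x r k))

poch-at-0 : ∀ r k → poch 0ℚ r k ≡ 1ℚ
poch-at-0 r zero    = refl
poch-at-0 r (suc k) = trans (cong (_* (1ℚ - 0ℚ * r ^ k)) (poch-at-0 r k))
                            (solve 1 (λ y → con 1ℚ :* (con 1ℚ :- con 0ℚ :* y) := con 1ℚ) refl (r ^ k))

poch-self≢0 : ∀ {r} → NotRootOfUnity r → ∀ k → poch r r k ≢ 0ℚ
poch-self≢0 r-nru zero    = ℚₚ.1≢0
poch-self≢0 r-nru (suc k) = *-≢0 (poch-self≢0 r-nru k) (1-x≢0 (r-nru (suc k) (s≤s z≤n)))

-- [n; k]_r on natural indices.  Because of the truncated suc n ∸ k it agrees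
-- with gauss r (+ n) (+ k) only for k ≤ n + 1 or r ≢ 0 (gauss≡qBinom-≢0).
qBinom : ℚ → ℕ → ℕ → ℚ
qBinom r n k = poch (r ^ (suc n ∸ k)) r k ⊘ poch r r k

gauss≡qBinom : ∀ r n k → k ≤ suc n → gauss r (+ n) (+ k) ≡ qBinom r n k
gauss≡qBinom r n k k≤1+n = cong (λ e → poch (r ^ᶻ e) r k ⊘ poch r r k) (begin
  + n ℤ.- + k ℤ.+ + 1  ≡⟨ shuffle (+ n) (+ k) ⟩
  + suc n ℤ.- + k      ≡⟨ ℤₚ.m-n≡m⊖n (suc n) k ⟩
  suc n ℤ.⊖ k          ≡⟨ ℤₚ.⊖-≥ k≤1+n ⟩
  + (suc n ∸ k)        ∎)
  where
  shuffle : ∀ x y → x ℤ.- y ℤ.+ + 1 ≡ + 1 ℤ.+ x ℤ.- y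
  shuffle = ℤ-Ring.solve-∀

qBinom-above : ∀ r {n k} → n < k → qBinom r n k ≡ 0ℚ
qBinom-above r {n} {k} n<k = begin
  poch (r ^ (suc n ∸ k)) r k ⊘ poch r r k
    ≡⟨ cong (λ e → poch (r ^ e) r k ⊘ poch r r k) (ℕₚ.m≤n⇒m∸n≡0 n<k) ⟩
  poch 1ℚ r k ⊘ poch r r k
    ≡⟨ cong (_⊘ poch r r k) (poch-vanishes 1ℚ r k refl (ℕₚ.≤-trans (s≤s z≤n) n<k)) ⟩
  0ℚ ⊘ poch r r k
    ≡⟨ 0⊘ (poch r r k) ⟩
  0ℚ ∎

qBinom-at-0 : ∀ {n k} → k ≤ n → qBinom 0ℚ n k ≡ 1ℚ
qBinom-at-0 {n} {k} k≤n = cong₂ _⊘_ numerator (poch-at-0 0ℚ k)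
  where
  numerator : poch (0ℚ ^ (suc n ∸ k)) 0ℚ k ≡ 1ℚ
  numerator = begin
    poch (0ℚ ^ (suc n ∸ k)) 0ℚ k   ≡⟨ cong (λ e → poch (0ℚ ^ e) 0ℚ k) (ℕₚ.+-∸-assoc 1 k≤n) ⟩
    poch (0ℚ * 0ℚ ^ (n ∸ k)) 0ℚ k  ≡⟨ cong (λ x → poch x 0ℚ k) (ℚₚ.*-zeroˡ (0ℚ ^ (n ∸ k))) ⟩
    poch 0ℚ 0ℚ k                   ≡⟨ poch-at-0 0ℚ k ⟩
    1ℚ                             ∎

gauss≡qBinom-≢0 : ∀ r → r ≢ 0ℚ → ∀ n k → gauss r (+ n) (+ k) ≡ qBinom r n k
gauss≡qBinom-≢0 r r≢0 n k with k ≤? suc n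
... | yes k≤1+n = gauss≡qBinom r n k k≤1+n
... | no k≰1+n with ℕₚ.m≤n⇒∃[o]m+o≡n (ℕₚ.≰⇒> k≰1+n)
...   | d , refl = begin
  poch (r ^ᶻ (+ n ℤ.- + k ℤ.+ + 1)) r k ⊘ poch r r k
    ≡⟨ cong (λ e → poch (r ^ᶻ e) r k ⊘ poch r r k) (exponent (+ n) (+ d)) ⟩
  poch (1ℚ ⊘ (r ^ suc d)) r k ⊘ poch r r k
    ≡⟨ cong (_⊘ poch r r k) (poch-vanishes _ r k (⊘*-cancel 1ℚ (r ^ suc d) (^-≢0 (suc d) r≢0))
                                                 (s≤s (s≤s (ℕₚ.m≤n+m d n)))) ⟩
  0ℚ ⊘ poch r r k
    ≡⟨ 0⊘ (poch r r k) ⟩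
  0ℚ
    ≡⟨ sym (qBinom-above r (ℕₚ.m≤n⇒m≤1+n (ℕₚ.m≤m+n (suc n) d))) ⟩
  qBinom r n k ∎
  where
  exponent : ∀ x y → x ℤ.- (+ 2 ℤ.+ x ℤ.+ y) ℤ.+ + 1 ≡ ℤ.- (+ 1 ℤ.+ y)
  exponent = ℤ-Ring.solve-∀

gauss-above : ∀ r → r ≢ 0ℚ → ∀ {n k} → n < k → gauss r (+ n) (+ k) ≡ 0ℚ
gauss-above r r≢0 {n} {k} n<k = trans (gauss≡qBinom-≢0 r r≢0 n k) (qBinom-above r n<k)

qBinom-pascal : ∀ r → NotRootOfUnity r → ∀ n k → k ≤ n →
                qBinom r (suc n) (suc k) ≡ qBinom r n (suc k) + r ^ (n ∸ k) * qBinom r n k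
qBinom-pascal r r-nru n k k≤n = *-cancelʳ-≡ _ _ B′ B′≢0 (begin
  qBinom r (suc n) (suc k) * B′
    ≡⟨ ⊘*-cancel _ B′ B′≢0 ⟩
  poch (r ^ (suc n ∸ k)) r (suc k)
    ≡⟨ cong (λ e → A * (1ℚ - r ^ e * R)) 1+n∸k ⟩
  A * (1ℚ - r * X * R)
    ≡⟨ solve 4 (λ A X r R → A :* (con 1ℚ :- r :* X :* R)
                          := (con 1ℚ :- X) :* A :+ X :* A :* (con 1ℚ :- r :* R)) refl A X r R ⟩
  (1ℚ - X) * A + X * A * (1ℚ - r * R)
    ≡⟨ cong₂ (λ u v → u + X * v * (1ℚ - r * R)) (sym numerator) (sym (⊘*-cancel A B (poch-self≢0 r-nru k))) ⟩
  poch X r (suc k) + X * (qBinom r n k * B) * (1ℚ - r * R)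
    ≡⟨ cong (_+ X * (qBinom r n k * B) * (1ℚ - r * R)) (sym (⊘*-cancel _ B′ B′≢0)) ⟩
  qBinom r n (suc k) * B′ + X * (qBinom r n k * B) * (1ℚ - r * R)
    ≡⟨ solve 5 (λ u v B X c → u :* (B :* c) :+ X :* (v :* B) :* c := (u :+ X :* v) :* (B :* c))
               refl (qBinom r n (suc k)) (qBinom r n k) B X (1ℚ - r * R) ⟩
  (qBinom r n (suc k) + X * qBinom r n k) * B′ ∎)
  where
  X = r ^ (n ∸ k)
  R = r ^ k
  A = poch (r ^ (suc n ∸ k)) r k
  B = poch r r k
  B′ = poch r r (suc k)
  B′≢0 = poch-self≢0 r-nru (suc k)
  1+n∸k : suc n ∸ k ≡ suc (n ∸ k)
  1+n∸k = ℕₚ.+-∸-assoc 1 k≤n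
  numerator : poch X r (suc k) ≡ (1ℚ - X) * A
  numerator = trans (poch-head X r k)
    (cong (λ y → (1ℚ - X) * poch y r k) (trans (ℚₚ.*-comm X r) (cong (r ^_) (sym 1+n∸k))))

-- Formal power series

-- Coefficient sequences of power series in x: one is the series 1, shift f is
-- x·f, timesLinear c f is (1 + c x)·f, dilate c f is f(c x) and f ⊛ g is f·g.
Coeffs : Set
Coeffs = ℕ → ℚ

one : Coeffs
one zero    = 1ℚ
one (suc _) = 0ℚ

shift : Coeffs → Coeffs
shift f zero    = 0ℚ
shift f (suc m) = f m

timesLinear : ℚ → Coeffs → Coeffs
timesLinear c f m = f m + c * shift f m

dilate : ℚ → Coeffs → Coeffs
dilate c f m = c ^ m * f m

infixl 7 _⊛_
_⊛_ : Coeffs → Coeffs → Coeffs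
(f ⊛ g) zero    = f 0 * g 0
(f ⊛ g) (suc m) = f 0 * g (suc m) + ((f ∘ suc) ⊛ g) m

⊛-cong : ∀ {f f′ g g′} → f ≗ f′ → g ≗ g′ → f ⊛ g ≗ f′ ⊛ g′
⊛-cong f≗f′ g≗g′ zero    = cong₂ _*_ (f≗f′ 0) (g≗g′ 0)
⊛-cong f≗f′ g≗g′ (suc m) =
  cong₂ _+_ (cong₂ _*_ (f≗f′ 0) (g≗g′ (suc m))) (⊛-cong (f≗f′ ∘ suc) g≗g′ m)

zero-⊛ : ∀ g → (λ _ → 0ℚ) ⊛ g ≗ λ _ → 0ℚ
zero-⊛ g zero    = ℚₚ.*-zeroˡ (g 0)
zero-⊛ g (suc m) = trans (cong₂ _+_ (ℚₚ.*-zeroˡ (g (suc m))) (zero-⊛ g m)) (ℚₚ.+-identityˡ 0ℚ)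

one-⊛ : ∀ g → one ⊛ g ≗ g
one-⊛ g zero    = ℚₚ.*-identityˡ (g 0)
one-⊛ g (suc m) = trans (cong₂ _+_ (ℚₚ.*-identityˡ (g (suc m))) (zero-⊛ g m)) (ℚₚ.+-identityʳ (g (suc m)))

⊛-distribʳ-+ : ∀ f f′ g → (λ a → f a + f′ a) ⊛ g ≗ λ m → (f ⊛ g) m + (f′ ⊛ g) m
⊛-distribʳ-+ f f′ g zero    = ℚₚ.*-distribʳ-+ (g 0) (f 0) (f′ 0)
⊛-distribʳ-+ f f′ g (suc m) = trans
  (cong (λ u → (f 0 + f′ 0) * g (suc m) + u) (⊛-distribʳ-+ (f ∘ suc) (f′ ∘ suc) g m))
  (solve 5 (λ a b c x y → (a :+ b) :* c :+ (x :+ y) := (a :* c :+ x) :+ (b :* c :+ y))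
           refl (f 0) (f′ 0) (g (suc m)) _ _)

⊛-distribˡ-+ : ∀ f g g′ → f ⊛ (λ a → g a + g′ a) ≗ λ m → (f ⊛ g) m + (f ⊛ g′) m
⊛-distribˡ-+ f g g′ zero    = ℚₚ.*-distribˡ-+ (f 0) (g 0) (g′ 0)
⊛-distribˡ-+ f g g′ (suc m) = trans
  (cong (λ u → f 0 * (g (suc m) + g′ (suc m)) + u) (⊛-distribˡ-+ (f ∘ suc) g g′ m))
  (solve 5 (λ a b c x y → c :* (a :+ b) :+ (x :+ y) := (c :* a :+ x) :+ (c :* b :+ y))
           refl (g (suc m)) (g′ (suc m)) (f 0) _ _)

⊛-scaleˡ : ∀ c f g → (λ a → c * f a) ⊛ g ≗ λ m → c * (f ⊛ g) m
⊛-scaleˡ c f g zero    = ℚₚ.*-assoc c (f 0) (g 0)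
⊛-scaleˡ c f g (suc m) = trans
  (cong (λ u → c * f 0 * g (suc m) + u) (⊛-scaleˡ c (f ∘ suc) g m))
  (solve 4 (λ c a b x → c :* a :* b :+ c :* x := c :* (a :* b :+ x)) refl c (f 0) (g (suc m)) _)

⊛-scaleʳ : ∀ c f g → f ⊛ (λ a → c * g a) ≗ λ m → c * (f ⊛ g) m
⊛-scaleʳ c f g zero    = solve 3 (λ c a b → a :* (c :* b) := c :* (a :* b)) refl c (f 0) (g 0)
⊛-scaleʳ c f g (suc m) = trans
  (cong (λ u → f 0 * (c * g (suc m)) + u) (⊛-scaleʳ c (f ∘ suc) g m))
  (solve 4 (λ c a b x → a :* (c :* b) :+ c :* x := c :* (a :* b :+ x)) refl c (f 0) (g (suc m)) _)

shift-⊛ : ∀ f g → shift f ⊛ g ≗ shift (f ⊛ g)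
shift-⊛ f g zero    = ℚₚ.*-zeroˡ (g 0)
shift-⊛ f g (suc m) = trans (cong (_+ (f ⊛ g) m) (ℚₚ.*-zeroˡ (g (suc m)))) (ℚₚ.+-identityˡ _)

⊛-shift : ∀ f g → f ⊛ shift g ≗ shift (f ⊛ g)
⊛-shift f g zero          = ℚₚ.*-zeroʳ (f 0)
⊛-shift f g (suc zero)    = trans (cong (λ u → f 0 * g 0 + u) (ℚₚ.*-zeroʳ (f 1))) (ℚₚ.+-identityʳ _)
⊛-shift f g (suc (suc m)) = cong (λ u → f 0 * g (suc m) + u) (⊛-shift (f ∘ suc) g (suc m))

timesLinear-cong : ∀ {c c′ f f′} → c ≡ c′ → f ≗ f′ → timesLinear c f ≗ timesLinear c′ f′
timesLinear-cong c≡c′ f≗f′ zero    = cong₂ (λ u c → u + c * 0ℚ) (f≗f′ 0) c≡c′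
timesLinear-cong c≡c′ f≗f′ (suc m) = cong₂ _+_ (f≗f′ (suc m)) (cong₂ _*_ c≡c′ (f≗f′ m))

timesLinear-⊛ : ∀ c f g → timesLinear c f ⊛ g ≗ timesLinear c (f ⊛ g)
timesLinear-⊛ c f g m = begin
  (timesLinear c f ⊛ g) m                    ≡⟨ ⊛-distribʳ-+ f (λ a → c * shift f a) g m ⟩
  (f ⊛ g) m + ((λ a → c * shift f a) ⊛ g) m  ≡⟨ cong (λ u → (f ⊛ g) m + u) (⊛-scaleˡ c (shift f) g m) ⟩
  (f ⊛ g) m + c * (shift f ⊛ g) m            ≡⟨ cong (λ u → (f ⊛ g) m + c * u) (shift-⊛ f g m) ⟩
  timesLinear c (f ⊛ g) m                    ∎

⊛-timesLinear : ∀ c f g → f ⊛ timesLinear c g ≗ timesLinear c (f ⊛ g)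
⊛-timesLinear c f g m = begin
  (f ⊛ timesLinear c g) m                    ≡⟨ ⊛-distribˡ-+ f g (λ a → c * shift g a) m ⟩
  (f ⊛ g) m + (f ⊛ (λ a → c * shift g a)) m  ≡⟨ cong (λ u → (f ⊛ g) m + u) (⊛-scaleʳ c f (shift g) m) ⟩
  (f ⊛ g) m + c * (f ⊛ shift g) m            ≡⟨ cong (λ u → (f ⊛ g) m + c * u) (⊛-shift f g m) ⟩
  timesLinear c (f ⊛ g) m                    ∎

timesLinear-comm : ∀ a b f → timesLinear a (timesLinear b f) ≗ timesLinear b (timesLinear a f)
timesLinear-comm a b f zero    =
  solve 3 (λ a b x → x :+ b :* con 0ℚ :+ a :* con 0ℚ := x :+ a :* con 0ℚ :+ b :* con 0ℚ) refl a b (f 0)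
timesLinear-comm a b f (suc m) =
  solve 5 (λ a b x y z → (x :+ b :* y) :+ a :* (y :+ b :* z) := (x :+ a :* y) :+ b :* (y :+ a :* z))
          refl a b (f (suc m)) (f m) (shift f m)

dilate-timesLinear : ∀ c a f → dilate c (timesLinear a f) ≗ timesLinear (c * a) (dilate c f)
dilate-timesLinear c a f zero    =
  solve 3 (λ c a x → con 1ℚ :* (x :+ a :* con 0ℚ) := con 1ℚ :* x :+ c :* a :* con 0ℚ) refl c a (f 0)
dilate-timesLinear c a f (suc m) =
  solve 5 (λ c a cᵐ x y → c :* cᵐ :* (x :+ a :* y) := c :* cᵐ :* x :+ c :* a :* (cᵐ :* y))
          refl c a (c ^ m) (f (suc m)) (f m)

dilate-one : ∀ c → dilate c one ≗ one
dilate-one c zero    = refl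
dilate-one c (suc m) = ℚₚ.*-zeroʳ (c ^ suc m)

qProd : ℚ → ℕ → Coeffs
qProd r zero    = one
qProd r (suc n) = timesLinear (r ^ n) (qProd r n)

qProd-0 : ∀ r n → qProd r n 0 ≡ 1ℚ
qProd-0 r zero    = refl
qProd-0 r (suc n) = trans (cong₂ _+_ (qProd-0 r n) (ℚₚ.*-zeroʳ (r ^ n))) (ℚₚ.+-identityʳ 1ℚ)

qProd-above : ∀ r {n k} → n < k → qProd r n k ≡ 0ℚ
qProd-above r {zero}  {suc k} _         = refl
qProd-above r {suc n} {suc k} (s≤s n<k) = begin
  qProd r n (suc k) + r ^ n * qProd r n k  ≡⟨ cong₂ (λ u v → u + r ^ n * v)
                                                    (qProd-above r (ℕₚ.m<n⇒m<1+n n<k)) (qProd-above r n<k) ⟩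
  0ℚ + r ^ n * 0ℚ                          ≡⟨ trans (ℚₚ.+-identityˡ _) (ℚₚ.*-zeroʳ (r ^ n)) ⟩
  0ℚ                                       ∎

qBinomial-theorem : ∀ r → NotRootOfUnity r → ∀ n k → qProd r n k ≡ r ^ tri k * qBinom r n k
qBinomial-theorem r r-nru n       zero    = qProd-0 r n
qBinomial-theorem r r-nru zero    (suc k) = sym (trans (cong (r ^ tri (suc k) *_) (qBinom-above r {zero} {suc k} (s≤s z≤n)))
                                                       (ℚₚ.*-zeroʳ (r ^ tri (suc k))))
qBinomial-theorem r r-nru (suc n) (suc k) with k ≤? n
... | no k≰n = trans (qProd-above r (s≤s n<k))
                     (sym (trans (cong (r ^ tri (suc k) *_) (qBinom-above r (s≤s n<k)))
                                 (ℚₚ.*-zeroʳ (r ^ tri (suc k)))))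
  where n<k = ℕₚ.≰⇒> k≰n
... | yes k≤n = begin
  qProd r n (suc k) + r ^ n * qProd r n k
    ≡⟨ cong₂ (λ u v → u + r ^ n * v) (qBinomial-theorem r r-nru n (suc k)) (qBinomial-theorem r r-nru n k) ⟩
  r ^ (k ℕ.+ tri k) * G₁ + r ^ n * (r ^ tri k * G₀)
    ≡⟨ cong₂ (λ u v → u * G₁ + v * (r ^ tri k * G₀)) (^-+ r k (tri k))
             (trans (cong (r ^_) (sym (ℕₚ.m+[n∸m]≡n k≤n))) (^-+ r k (n ∸ k))) ⟩
  r ^ k * r ^ tri k * G₁ + r ^ k * r ^ (n ∸ k) * (r ^ tri k * G₀)
    ≡⟨ solve 5 (λ a b c g₁ g₀ → a :* b :* g₁ :+ a :* c :* (b :* g₀) := a :* b :* (g₁ :+ c :* g₀))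
               refl (r ^ k) (r ^ tri k) (r ^ (n ∸ k)) G₁ G₀ ⟩
  r ^ k * r ^ tri k * (G₁ + r ^ (n ∸ k) * G₀)
    ≡⟨ cong₂ _*_ (sym (^-+ r k (tri k))) (sym (qBinom-pascal r r-nru n k k≤n)) ⟩
  r ^ tri (suc k) * qBinom r (suc n) (suc k) ∎
  where
  G₁ = qBinom r n (suc k)
  G₀ = qBinom r n k

qProd-double : ∀ p L → qProd p (L ℕ.+ L) ≗ dilate p (qProd (p * p) L) ⊛ qProd (p * p) L
qProd-double p zero    m = sym (trans (⊛-cong (dilate-one p) (λ _ → refl) m) (one-⊛ one m))
qProd-double p (suc L) m = begin
  qProd p (suc L ℕ.+ suc L) m
    ≡⟨ cong (λ n → qProd p n m) (cong suc (ℕₚ.+-suc L L)) ⟩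
  timesLinear (p ^ suc n) (timesLinear (p ^ n) (qProd p n)) m
    ≡⟨ timesLinear-cong {p ^ suc n} refl (timesLinear-cong {p ^ n} refl (qProd-double p L)) m ⟩
  timesLinear (p ^ suc n) (timesLinear (p ^ n) (h ⊛ e)) m
    ≡⟨ timesLinear-comm (p ^ suc n) (p ^ n) (h ⊛ e) m ⟩
  timesLinear (p ^ n) (timesLinear (p ^ suc n) (h ⊛ e)) m
    ≡⟨ sym (timesLinear-cong (^-square p L)
                             (timesLinear-cong {f = h ⊛ e} (cong (p *_) (^-square p L)) λ _ → refl) m) ⟩
  timesLinear (q ^ L) (timesLinear (p * q ^ L) (h ⊛ e)) m
    ≡⟨ sym (timesLinear-cong {q ^ L} refl (timesLinear-⊛ (p * q ^ L) h e) m) ⟩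
  timesLinear (q ^ L) (timesLinear (p * q ^ L) h ⊛ e) m
    ≡⟨ sym (⊛-timesLinear (q ^ L) (timesLinear (p * q ^ L) h) e m) ⟩
  (timesLinear (p * q ^ L) h ⊛ timesLinear (q ^ L) e) m
    ≡⟨ sym (⊛-cong (dilate-timesLinear p (q ^ L) e) (λ _ → refl) m) ⟩
  (dilate p (qProd q (suc L)) ⊛ qProd q (suc L)) m ∎
  where
  n = L ℕ.+ L
  q = p * p
  e = qProd q L
  h = dilate p e

-- Finite sums

sumTo : (ℕ → ℚ) → ℕ → ℚ
sumTo f zero    = 0ℚ
sumTo f (suc n) = f 0 + sumTo (f ∘ suc) n

sumTo-cong : ∀ {f g} n → (∀ i → i < n → f i ≡ g i) → sumTo f n ≡ sumTo g n
sumTo-cong zero    f≡g = refl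
sumTo-cong (suc n) f≡g = cong₂ _+_ (f≡g 0 (s≤s z≤n)) (sumTo-cong n (λ i i<n → f≡g (suc i) (s≤s i<n)))

sumTo-scale : ∀ c f n → sumTo (λ i → c * f i) n ≡ c * sumTo f n
sumTo-scale c f zero    = sym (ℚₚ.*-zeroʳ c)
sumTo-scale c f (suc n) = trans (cong (_+_ (c * f 0)) (sumTo-scale c (f ∘ suc) n))
                                (sym (ℚₚ.*-distribˡ-+ c (f 0) _))

sumTo-snoc : ∀ f n → sumTo f (suc n) ≡ sumTo f n + f n
sumTo-snoc f zero    = trans (ℚₚ.+-identityʳ (f 0)) (sym (ℚₚ.+-identityˡ (f 0)))
sumTo-snoc f (suc n) = trans (cong (_+_ (f 0)) (sumTo-snoc (f ∘ suc) n)) (sym (ℚₚ.+-assoc (f 0) _ _))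

⊛-sumTo : ∀ f g m → (f ⊛ g) m ≡ sumTo (λ a → f a * g (m ∸ a)) (suc m)
⊛-sumTo f g zero    = sym (ℚₚ.+-identityʳ (f 0 * g 0))
⊛-sumTo f g (suc m) = cong (_+_ (f 0 * g (suc m))) (⊛-sumTo (f ∘ suc) g m)

sumSym-sumTo : ∀ M f → sumSym M f ≡ sumTo (λ i → f (+ i ℤ.- + M)) (suc (M ℕ.+ M))
sumSym-sumTo M f = trans (foldr-applyUpTo (suc (2 ℕ.* M)) (λ i → i))
                         (cong (λ n → sumTo (λ i → f (+ i ℤ.- + M)) (suc n)) (2*n≡n+n M))
  where
  foldr-applyUpTo : ∀ n h → foldr (λ i acc → f (+ i ℤ.- + M) + acc) 0ℚ (applyUpTo h n)
                          ≡ sumTo (λ i → f (+ h i ℤ.- + M)) n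
  foldr-applyUpTo zero    h = refl
  foldr-applyUpTo (suc n) h = cong (_+_ (f (+ h 0 ℤ.- + M))) (foldr-applyUpTo n (h ∘ suc))

sumSym-zero : ∀ f → sumSym 0 f ≡ f (+ 0)
sumSym-zero f = ℚₚ.+-identityʳ (f (+ 0))

sumSym-suc : ∀ s f → sumSym (suc s) f ≡ f -[1+ s ] + sumSym s f + f (+ suc s)
sumSym-suc s f = begin
  sumSym (suc s) f
    ≡⟨ sumSym-sumTo (suc s) f ⟩
  f -[1+ s ] + sumTo (F ∘ suc) (suc (s ℕ.+ suc s))
    ≡⟨ cong (λ n → f -[1+ s ] + sumTo (F ∘ suc) (suc n)) (ℕₚ.+-suc s s) ⟩
  f -[1+ s ] + sumTo (F ∘ suc) (suc (suc (s ℕ.+ s)))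
    ≡⟨ cong (_+_ (f -[1+ s ])) (sumTo-snoc (F ∘ suc) (suc (s ℕ.+ s))) ⟩
  f -[1+ s ] + (sumTo (F ∘ suc) (suc (s ℕ.+ s)) + F (suc (suc (s ℕ.+ s))))
    ≡⟨ cong₂ (λ u v → f -[1+ s ] + (u + f v))
             (sumTo-cong (suc (s ℕ.+ s)) (λ i _ → cong f (cancel-1 (+ i) (+ s)))) (last (+ s)) ⟩
  f -[1+ s ] + (sumTo (λ i → f (+ i ℤ.- + s)) (suc (s ℕ.+ s)) + f (+ suc s))
    ≡⟨ cong (λ u → f -[1+ s ] + (u + f (+ suc s))) (sym (sumSym-sumTo s f)) ⟩
  f -[1+ s ] + (sumSym s f + f (+ suc s))
    ≡⟨ sym (ℚₚ.+-assoc (f -[1+ s ]) (sumSym s f) (f (+ suc s))) ⟩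
  f -[1+ s ] + sumSym s f + f (+ suc s) ∎
  where
  F : ℕ → ℚ
  F i = f (+ i ℤ.- + suc s)
  cancel-1 : ∀ x y → + 1 ℤ.+ x ℤ.- (+ 1 ℤ.+ y) ≡ x ℤ.- y
  cancel-1 = ℤ-Ring.solve-∀
  last : ∀ x → + 2 ℤ.+ x ℤ.+ x ℤ.- (+ 1 ℤ.+ x) ≡ + 1 ℤ.+ x
  last = ℤ-Ring.solve-∀

sumSym-shrink : ∀ s d f → (∀ j → s < ∣ j ∣ → f j ≡ 0ℚ) → sumSym (s ℕ.+ d) f ≡ sumSym s f
sumSym-shrink s zero    f vanish = cong (λ n → sumSym n f) (ℕₚ.+-identityʳ s)
sumSym-shrink s (suc d) f vanish = begin
  sumSym (s ℕ.+ suc d) f                                       ≡⟨ cong (λ n → sumSym n f) (ℕₚ.+-suc s d) ⟩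
  sumSym (suc (s ℕ.+ d)) f                                     ≡⟨ sumSym-suc (s ℕ.+ d) f ⟩
  f -[1+ s ℕ.+ d ] + sumSym (s ℕ.+ d) f + f (+ suc (s ℕ.+ d))  ≡⟨ cong₂ (λ u v → u + sumSym (s ℕ.+ d) f + v)
                                                                        (vanish _ s<) (vanish _ s<) ⟩
  0ℚ + sumSym (s ℕ.+ d) f + 0ℚ                                 ≡⟨ trans (ℚₚ.+-identityʳ _)
                                                                        (ℚₚ.+-identityˡ _) ⟩
  sumSym (s ℕ.+ d) f                                           ≡⟨ sumSym-shrink s d f vanish ⟩
  sumSym s f                                                   ∎
  where
  s< : s < suc (s ℕ.+ d)
  s< = s≤s (ℕₚ.m≤m+n s d)

sumSym-support : ∀ m n f → (∀ j → m < ∣ j ∣ → f j ≡ 0ℚ) → (∀ j → n < ∣ j ∣ → f j ≡ 0ℚ) →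
                 sumSym m f ≡ sumSym n f
sumSym-support m n f vanish-m vanish-n = begin
  sumSym m f          ≡⟨ sym (sumSym-shrink m n f vanish-m) ⟩
  sumSym (m ℕ.+ n) f  ≡⟨ cong (λ k → sumSym k f) (ℕₚ.+-comm m n) ⟩
  sumSym (n ℕ.+ m) f  ≡⟨ sumSym-shrink n m f vanish-n ⟩
  sumSym n f          ∎

term : ℚ → ℕ → ℕ → ℤ → ℚ
term p N M j = p ^ ∣ expo j ∣ * Q (+ N) (+ M) j j (p * p)

Q-diagonal : ∀ N M j q →
             Q (+ N) (+ M) j j q ≡ gauss q (+ (N ℕ.+ M)) (+ N ℤ.+ j) * gauss q (+ (N ℕ.+ M)) (+ N ℤ.- j)
Q-diagonal N M j q =
  cong₂ (λ x y → gauss q x (+ N ℤ.+ j) * gauss q y (+ N ℤ.- j)) (cancel₁ (+ N) (+ M) j) (cancel₂ (+ N) (+ M) j)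
  where
  cancel₁ : ∀ x y j → x ℤ.+ y ℤ.+ j ℤ.- j ≡ x ℤ.+ y
  cancel₁ = ℤ-Ring.solve-∀
  cancel₂ : ∀ x y j → x ℤ.+ y ℤ.- j ℤ.+ j ≡ x ℤ.+ y
  cancel₂ = ℤ-Ring.solve-∀

Q-vanishes-N : ∀ N M q j → N < ∣ j ∣ → Q (+ N) (+ M) j j q ≡ 0ℚ
Q-vanishes-N N M q (+ t) N<t with ℕₚ.m≤n⇒∃[o]m+o≡n N<t
... | d , refl = begin
  Q (+ N) (+ M) (+ t) (+ t) q              ≡⟨ Q-diagonal N M (+ t) q ⟩
  G * gauss q (+ L) (+ N ℤ.- + t)          ≡⟨ cong (λ i → G * gauss q (+ L) i) (below (+ N) (+ d)) ⟩
  G * 0ℚ                                   ≡⟨ ℚₚ.*-zeroʳ G ⟩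
  0ℚ                                       ∎
  where
  L = N ℕ.+ M
  G = gauss q (+ L) (+ (N ℕ.+ t))
  below : ∀ x y → x ℤ.- (+ 1 ℤ.+ x ℤ.+ y) ≡ ℤ.- (+ 1 ℤ.+ y)
  below = ℤ-Ring.solve-∀
Q-vanishes-N N M q -[1+ t ] N<1+t with ℕₚ.m≤n⇒∃[o]m+o≡n N<1+t
... | d , refl = begin
  Q (+ N) (+ M) -[1+ t ] -[1+ t ] q        ≡⟨ Q-diagonal N M -[1+ t ] q ⟩
  gauss q (+ L) (+ N ℤ.+ -[1+ t ]) * G     ≡⟨ cong (λ i → gauss q (+ L) i * G) (below (+ N) (+ d)) ⟩
  0ℚ * G                                   ≡⟨ ℚₚ.*-zeroˡ G ⟩
  0ℚ                                       ∎
  where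
  L = N ℕ.+ M
  G = gauss q (+ L) (+ (N ℕ.+ suc t))
  below : ∀ x y → x ℤ.+ ℤ.- (+ 1 ℤ.+ x ℤ.+ y) ≡ ℤ.- (+ 1 ℤ.+ y)
  below = ℤ-Ring.solve-∀

-- q ≢ 0 is needed: gauss at a lower index above N + M + 1 is built on a
-- negative power of q, which is junk at q = 0.
Q-vanishes-M : ∀ N M q → q ≢ 0ℚ → ∀ j → M < ∣ j ∣ → Q (+ N) (+ M) j j q ≡ 0ℚ
Q-vanishes-M N M q q≢0 (+ t) M<t = begin
  Q (+ N) (+ M) (+ t) (+ t) q                ≡⟨ Q-diagonal N M (+ t) q ⟩
  gauss q (+ L) (+ (N ℕ.+ t)) * G            ≡⟨ cong (_* G) (gauss-above q q≢0 (ℕₚ.+-monoʳ-< N M<t)) ⟩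
  0ℚ * G                                     ≡⟨ ℚₚ.*-zeroˡ G ⟩
  0ℚ                                         ∎
  where
  L = N ℕ.+ M
  G = gauss q (+ L) (+ N ℤ.- + t)
Q-vanishes-M N M q q≢0 -[1+ t ] M<1+t = begin
  Q (+ N) (+ M) -[1+ t ] -[1+ t ] q          ≡⟨ Q-diagonal N M -[1+ t ] q ⟩
  G * gauss q (+ L) (+ (N ℕ.+ suc t))        ≡⟨ cong (G *_) (gauss-above q q≢0 (ℕₚ.+-monoʳ-< N M<1+t)) ⟩
  G * 0ℚ                                     ≡⟨ ℚₚ.*-zeroʳ G ⟩
  0ℚ                                         ∎
  where
  L = N ℕ.+ M
  G = gauss q (+ L) (+ N ℤ.+ -[1+ t ])

term-vanishes : ∀ p N M j → Q (+ N) (+ M) j j (p * p) ≡ 0ℚ → term p N M j ≡ 0ℚ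
term-vanishes p N M j Q≡0 = trans (cong (p ^ ∣ expo j ∣ *_) Q≡0) (ℚₚ.*-zeroʳ (p ^ ∣ expo j ∣))

0^∣expo∣ : ∀ j → 0 < ∣ j ∣ → 0ℚ ^ ∣ expo j ∣ ≡ 0ℚ
0^∣expo∣ (+ suc n) _ =
  trans (cong (λ i → 0ℚ ^ ∣ i ∣) (expo-+ (suc n))) (0^-pos (2 ℕ.* suc n ℕ.* suc n ℕ.+ suc n) (s≤s z≤n))
0^∣expo∣ -[1+ n ]  _ =
  trans (cong (λ i → 0ℚ ^ ∣ i ∣) (expo-[1+] n)) (0^-pos (suc (2 ℕ.* n ℕ.* n ℕ.+ 3 ℕ.* n)) (s≤s z≤n))

convolution-term : ∀ p → p ≢ 0ℚ → NotRootOfUnity p → ∀ N M b → b ≤ N ℕ.+ N →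
                   dilate p (qProd (p * p) (N ℕ.+ M)) b * qProd (p * p) (N ℕ.+ M) (N ℕ.+ N ∸ b)
                   ≡ p ^ tri (N ℕ.+ N) * term p N M (+ b ℤ.- + N)
convolution-term p p≢0 p-nru N M b b≤2N = begin
  p ^ b * qProd q L b * qProd q L a
    ≡⟨ cong₂ (λ u v → p ^ b * u * v) (qBinomial-theorem q q-nru L b) (qBinomial-theorem q q-nru L a) ⟩
  p ^ b * (q ^ tri b * G_b) * (q ^ tri a * G_a)
    ≡⟨ solve 5 (λ x y z u v → x :* (y :* u) :* (z :* v) := z :* (x :* y) :* (u :* v))
               refl (p ^ b) (q ^ tri b) (q ^ tri a) G_b G_a ⟩
  q ^ tri a * (p ^ b * q ^ tri b) * (G_b * G_a)
    ≡⟨ sym (cong₂ _*_ powers (cong₂ _*_ (gauss≡ N+j≡b) (gauss≡ N-j≡a))) ⟩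
  p ^ c * p ^ e * (gauss q (+ L) (+ N ℤ.+ j) * gauss q (+ L) (+ N ℤ.- j))
    ≡⟨ cong (p ^ c * p ^ e *_) (sym (Q-diagonal N M j q)) ⟩
  p ^ c * p ^ e * Q (+ N) (+ M) j j q
    ≡⟨ ℚₚ.*-assoc (p ^ c) (p ^ e) _ ⟩
  p ^ c * term p N M j ∎
  where
  q = p * p
  L = N ℕ.+ M
  a = N ℕ.+ N ∸ b
  j = + b ℤ.- + N
  c = tri (N ℕ.+ N)
  e = ∣ expo j ∣
  G_b = qBinom q L b
  G_a = qBinom q L a
  q-nru = NotRootOfUnity-square p-nru
  N+j≡b : + N ℤ.+ j ≡ + b
  N+j≡b = cancel (+ N) (+ b)
    where
    cancel : ∀ x y → x ℤ.+ (y ℤ.- x) ≡ y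
    cancel = ℤ-Ring.solve-∀
  N-j≡a : + N ℤ.- j ≡ + a
  N-j≡a = begin
    + N ℤ.- (+ b ℤ.- + N)  ≡⟨ reflect (+ N) (+ b) ⟩
    + (N ℕ.+ N) ℤ.- + b    ≡⟨ cong (λ n → + n ℤ.- + b) (sym (ℕₚ.m∸n+n≡m b≤2N)) ⟩
    + a ℤ.+ + b ℤ.- + b    ≡⟨ cancel (+ a) (+ b) ⟩
    + a                    ∎
    where
    reflect : ∀ x y → x ℤ.- (y ℤ.- x) ≡ x ℤ.+ x ℤ.- y
    reflect = ℤ-Ring.solve-∀
    cancel : ∀ x y → x ℤ.+ y ℤ.- y ≡ x
    cancel = ℤ-Ring.solve-∀
  gauss≡ : ∀ {i k} → i ≡ + k → gauss q (+ L) i ≡ qBinom q L k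
  gauss≡ {k = k} refl = gauss≡qBinom-≢0 q (*-≢0 p≢0 p≢0) L k
  powers : p ^ c * p ^ e ≡ q ^ tri a * (p ^ b * q ^ tri b)
  powers = begin
    p ^ c * p ^ e
      ≡⟨ sym (^-+ p c e) ⟩
    p ^ (c ℕ.+ e)
      ≡⟨ cong (p ^_) (tri-exponent N a b j N-j≡a N+j≡b) ⟩
    p ^ ((tri a ℕ.+ tri a) ℕ.+ (b ℕ.+ (tri b ℕ.+ tri b)))
      ≡⟨ ^-+ p (tri a ℕ.+ tri a) _ ⟩
    p ^ (tri a ℕ.+ tri a) * p ^ (b ℕ.+ (tri b ℕ.+ tri b))
      ≡⟨ cong₂ _*_ (sym (^-square p (tri a))) (trans (^-+ p b _) (cong (p ^ b *_) (sym (^-square p (tri b))))) ⟩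
    q ^ tri a * (p ^ b * q ^ tri b) ∎

coefficient-identity : ∀ p → p ≢ 0ℚ → NotRootOfUnity p → ∀ N M →
                       p ^ tri (N ℕ.+ N) * qBinom p ((N ℕ.+ M) ℕ.+ (N ℕ.+ M)) (N ℕ.+ N)
                       ≡ p ^ tri (N ℕ.+ N) * sumSym N (term p N M)
coefficient-identity p p≢0 p-nru N M = begin
  p ^ c * qBinom p (L ℕ.+ L) (N ℕ.+ N)
    ≡⟨ sym (qBinomial-theorem p p-nru (L ℕ.+ L) (N ℕ.+ N)) ⟩
  qProd p (L ℕ.+ L) (N ℕ.+ N)
    ≡⟨ qProd-double p L (N ℕ.+ N) ⟩
  (dilate p e ⊛ e) (N ℕ.+ N)
    ≡⟨ ⊛-sumTo (dilate p e) e (N ℕ.+ N) ⟩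
  sumTo (λ b → dilate p e b * e (N ℕ.+ N ∸ b)) (suc (N ℕ.+ N))
    ≡⟨ sumTo-cong (suc (N ℕ.+ N)) (λ b b<1+2N → convolution-term p p≢0 p-nru N M b (ℕₚ.m<1+n⇒m≤n b<1+2N)) ⟩
  sumTo (λ b → p ^ c * term p N M (+ b ℤ.- + N)) (suc (N ℕ.+ N))
    ≡⟨ sumTo-scale (p ^ c) (λ b → term p N M (+ b ℤ.- + N)) (suc (N ℕ.+ N)) ⟩
  p ^ c * sumTo (λ b → term p N M (+ b ℤ.- + N)) (suc (N ℕ.+ N))
    ≡⟨ cong (p ^ c *_) (sym (sumSym-sumTo N (term p N M))) ⟩
  p ^ c * sumSym N (term p N M) ∎
  where
  c = tri (N ℕ.+ N)
  L = N ℕ.+ M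
  e = qProd (p * p) L

qBinom-identity-at-0 : ∀ N M → qBinom 0ℚ ((N ℕ.+ M) ℕ.+ (N ℕ.+ M)) (N ℕ.+ N) ≡ sumSym M (term 0ℚ N M)
qBinom-identity-at-0 N M = begin
  qBinom 0ℚ (L ℕ.+ L) (N ℕ.+ N)  ≡⟨ qBinom-at-0 (ℕₚ.+-mono-≤ N≤L N≤L) ⟩
  1ℚ                             ≡⟨ sym centre ⟩
  term 0ℚ N M (+ 0)              ≡⟨ sym (sumSym-zero (term 0ℚ N M)) ⟩
  sumSym 0 (term 0ℚ N M)         ≡⟨ sym (sumSym-shrink 0 M (term 0ℚ N M) off-centre) ⟩
  sumSym M (term 0ℚ N M)         ∎
  where
  L = N ℕ.+ M
  N≤L = ℕₚ.m≤m+n N M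
  off-centre : ∀ j → 0 < ∣ j ∣ → term 0ℚ N M j ≡ 0ℚ
  off-centre j 0<∣j∣ = trans (cong (_* Q (+ N) (+ M) j j (0ℚ * 0ℚ)) (0^∣expo∣ j 0<∣j∣))
                             (ℚₚ.*-zeroˡ (Q (+ N) (+ M) j j (0ℚ * 0ℚ)))
  binomial≡1 : gauss 0ℚ (+ L) (+ (N ℕ.+ 0)) ≡ 1ℚ
  binomial≡1 = trans (gauss≡qBinom 0ℚ L (N ℕ.+ 0) (ℕₚ.m≤n⇒m≤1+n N+0≤L)) (qBinom-at-0 N+0≤L)
    where N+0≤L = subst (_≤ L) (sym (ℕₚ.+-identityʳ N)) N≤L
  centre : term 0ℚ N M (+ 0) ≡ 1ℚ
  centre = begin
    1ℚ * Q (+ N) (+ M) (+ 0) (+ 0) (0ℚ * 0ℚ)                    ≡⟨ ℚₚ.*-identityˡ _ ⟩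
    Q (+ N) (+ M) (+ 0) (+ 0) (0ℚ * 0ℚ)                         ≡⟨ Q-diagonal N M (+ 0) (0ℚ * 0ℚ) ⟩
    gauss 0ℚ (+ L) (+ (N ℕ.+ 0)) * gauss 0ℚ (+ L) (+ (N ℕ.+ 0))  ≡⟨ cong₂ _*_ binomial≡1 binomial≡1 ⟩
    1ℚ                                                           ∎

qBinom-identity : ∀ p → NotRootOfUnity p → ∀ N M →
                  qBinom p ((N ℕ.+ M) ℕ.+ (N ℕ.+ M)) (N ℕ.+ N) ≡ sumSym M (term p N M)
qBinom-identity p p-nru N M with p ℚₚ.≟ 0ℚ
... | yes refl = qBinom-identity-at-0 N M
... | no p≢0   = begin
  qBinom p ((N ℕ.+ M) ℕ.+ (N ℕ.+ M)) (N ℕ.+ N)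
    ≡⟨ *-cancelˡ-≡ (p ^ tri (N ℕ.+ N)) _ _ (^-≢0 (tri (N ℕ.+ N)) p≢0)
                   (coefficient-identity p p≢0 p-nru N M) ⟩
  sumSym N (term p N M)
    ≡⟨ sumSym-support N M (term p N M)
         (λ j N<∣j∣ → term-vanishes p N M j (Q-vanishes-N N M (p * p) j N<∣j∣))
         (λ j M<∣j∣ → term-vanishes p N M j (Q-vanishes-M N M (p * p) (*-≢0 p≢0 p≢0) j M<∣j∣)) ⟩
  sumSym M (term p N M) ∎

mainTheorem13 : (p : ℚ) → (∀ (k : ℕ) → 1 ≤ k → p ^ k ≢ 1ℚ) → (N M : ℕ) →
    gauss p (+ (2 Data.Nat.* N Data.Nat.+ 2 Data.Nat.* M)) (+ (2 Data.Nat.* N))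
      ≡ sumSym M (λ j → (p ^ ∣ + 2 ℤ.* j ℤ.* j ℤ.+ j ∣) * Q (+ N) (+ M) j j (p * p))
mainTheorem13 p p-nru N M = begin
  gauss p (+ (2 ℕ.* N ℕ.+ 2 ℕ.* M)) (+ (2 ℕ.* N))
    ≡⟨ cong₂ (λ n k → gauss p (+ n) (+ k)) (2*[m+n] N M) (2*n≡n+n N) ⟩
  gauss p (+ (L ℕ.+ L)) (+ (N ℕ.+ N))
    ≡⟨ gauss≡qBinom p (L ℕ.+ L) (N ℕ.+ N) (ℕₚ.m≤n⇒m≤1+n (ℕₚ.+-mono-≤ N≤L N≤L)) ⟩
  qBinom p (L ℕ.+ L) (N ℕ.+ N)
    ≡⟨ qBinom-identity p p-nru N M ⟩
  sumSym M (term p N M) ∎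
  where
  L = N ℕ.+ M
  N≤L = ℕₚ.m≤m+n N M
  2*[m+n] : ∀ m n → 2 ℕ.* m ℕ.+ 2 ℕ.* n ≡ (m ℕ.+ n) ℕ.+ (m ℕ.+ n)
  2*[m+n] = ℕ-Ring.solve-∀
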